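{- Let $n$ be a positive integer or $\omega$, let $A$ be a Boolean algebra and $X\subseteq A$ an $n$-independent set generating $A$. Let $\mathscr G=\langle X,E\rangle$ be the hypergraph whose hyperedges are exactly those $e\subseteq X$ that are finite, satisfy $\prod e=0$, and satisfy $\prod f\neq0$ for every $f\subsetneq e$. Then $A\cong\mathrm{BA}(\mathscr G)$ (via the isomorphism extending $v\mapsto v_+$).
   Context: $X\subseteq A$ is $n$-independent ($n<\omega$) if $0\notin X$ and for all nonempty finite $F,G\subseteq X$: $\sum F\neq1$; if $\prod F=0$ then $\prod F'=0$ for some $F'\subseteq F$ with $|F'|\le n$; if $0\neq\prod F\le\sum G$ then $F\cap G\neq\emptyset$. $\omega$-independent means $0\notin X$ and the first and third conditions hold. For a hypergraph $\mathscr G=\langle V,E\rangle$, an anticlique is a set $T\subseteq V$ including no hyperedge; $A(\mathscr G)$ is the set of anticliques; $v_+=\{T\in A(\mathscr G):v\in T\}$; $\mathrm{BA}(\mathscr G)$ is the subalgebra of $\mathcal P(A(\mathscr G))$ generated by $\{v_+:v\in V\}$. -}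

module Defs where

open import Level using (0ℓ) renaming (suc to lsuc)
open import Data.Nat using (ℕ; _≤_)
open import Data.List using (List; []; _∷_; foldr; length)
open import Data.List.Relation.Unary.All using (All)
open import Data.List.Membership.Propositional using (_∈_)
open import Data.Product using (Σ; ∃; ∃-syntax; _×_; _,_)
open import Relation.Nullary using (¬_)
open import Relation.Unary using (Pred; _≐_; _∩_; _∪_; ∁; U; ∅)
  renaming (_∈_ to _∈ₚ_; _∉_ to _∉ₚ_; _⊆_ to _⊆ₚ_)
open import Relation.Binary.PropositionalEquality using (_≡_; _≢_)
open import Data.Unit using () renaming (⊤ to Unit)
open import Algebra.Core using (Op₁; Op₂)
import Algebra.Lattice.Structures as LS

record BA : Set₁ where
  field
    Carrier : Set
    _∨_ _∧_ : Op₂ Carrier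
    -_      : Op₁ Carrier
    ⊤ ⊥     : Carrier
    isBooleanAlgebra : LS.IsBooleanAlgebra {A = Carrier} _≡_ _∨_ _∧_ -_ ⊤ ⊥

data Card : Set where
  fin : ℕ → Card
  ω   : Card

data BTerm (V : Set) : Set where
  var      : V → BTerm V
  top bot  : BTerm V
  _and_ _or_ : BTerm V → BTerm V → BTerm V
  not      : BTerm V → BTerm V

module _ (𝔸 : BA) where
  open BA 𝔸

  -- product / sum of a finite set (given as a list)
  ∏ : List Carrier → Carrier
  ∏ = foldr _∧_ ⊤

  ∑ : List Carrier → Carrier
  ∑ = foldr _∨_ ⊥

  _≤ᴬ_ : Carrier → Carrier → Set
  a ≤ᴬ b = (a ∧ b) ≡ a

  NonEmpty : List Carrier → Set
  NonEmpty F = ∃[ x ] (x ∈ F)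

  NEFinSub : Pred Carrier 0ℓ → List Carrier → Set
  NEFinSub X F = NonEmpty F × All (_∈ₚ X) F

  Independent : Card → Pred Carrier 0ℓ → Set
  Independent n X =
      (⊥ ∉ₚ X)
    × (∀ F → NEFinSub X F → ∑ F ≢ ⊤)
    × Cond2 n
    × (∀ F G → NEFinSub X F → NEFinSub X G →
         ∏ F ≢ ⊥ → ∏ F ≤ᴬ ∑ G → ∃[ x ] (x ∈ F × x ∈ G))
    where
    Cond2 : Card → Set
    Cond2 (fin k) = ∀ F → NEFinSub X F → ∏ F ≡ ⊥ →
                      ∃[ F' ] (All (_∈ F) F' × length F' ≤ k × ∏ F' ≡ ⊥)
    Cond2 ω = Unit

  evalA : {V : Set} → (V → Carrier) → BTerm V → Carrier
  evalA ρ (var v) = ρ v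
  evalA ρ top = ⊤
  evalA ρ bot = ⊥
  evalA ρ (s and t) = evalA ρ s ∧ evalA ρ t
  evalA ρ (s or t) = evalA ρ s ∨ evalA ρ t
  evalA ρ (not t) = - evalA ρ t

  Vtx : Pred Carrier 0ℓ → Set
  Vtx X = Σ Carrier (_∈ₚ X)

  Generates : Pred Carrier 0ℓ → Set
  Generates X = ∀ a → ∃[ t ] (evalA {Vtx X} (λ { (x , _) → x }) t ≡ a)

  Hyperedge : Pred Carrier 0ℓ → List Carrier → Set
  Hyperedge X e =
      All (_∈ₚ X) e
    × ∏ e ≡ ⊥
    × (∀ f → All (_∈ e) f → (∃[ y ] (y ∈ e × ¬ (y ∈ f))) → ∏ f ≢ ⊥)

  IsAnticlique : Pred Carrier 0ℓ → Pred Carrier 0ℓ → Set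
  IsAnticlique X T = T ⊆ₚ X × (∀ e → Hyperedge X e → ¬ All (_∈ₚ T) e)

  Anticlique : Pred Carrier 0ℓ → Set₁
  Anticlique X = Σ (Pred Carrier 0ℓ) (IsAnticlique X)

  _₊ : {X : Pred Carrier 0ℓ} → Carrier → Pred (Anticlique X) 0ℓ
  (v ₊) (T , _) = v ∈ₚ T

  -- evaluation of Boolean terms in 𝒫(A(𝒢)); BA(𝒢) = {⟦t⟧ : t}
  ⟦_⟧ : {X : Pred Carrier 0ℓ} → BTerm (Vtx X) → Pred (Anticlique X) 0ℓ
  ⟦ var (v , _) ⟧ = v ₊
  ⟦ top ⟧ = U
  ⟦ bot ⟧ = ∅
  ⟦ s and t ⟧ = ⟦ s ⟧ ∩ ⟦ t ⟧
  ⟦ s or t ⟧ = ⟦ s ⟧ ∪ ⟦ t ⟧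
  ⟦ not t ⟧ = ∁ ⟦ t ⟧

  IsIsoOntoBA𝒢 : (X : Pred Carrier 0ℓ) → (Carrier → Pred (Anticlique X) 0ℓ) → Set₁
  IsIsoOntoBA𝒢 X φ =
      (∀ a b → φ (a ∧ b) ≐ (φ a ∩ φ b))
    × (∀ a b → φ (a ∨ b) ≐ (φ a ∪ φ b))
    × (∀ a → φ (- a) ≐ ∁ (φ a))
    × (φ ⊤ ≐ U)
    × (φ ⊥ ≐ ∅)
    × (∀ a b → φ a ≐ φ b → a ≡ b)
    × (∀ x → x ∈ₚ X → φ x ≐ (x ₊))
    × (∀ a → ∃[ t ] (φ a ≐ ⟦ t ⟧))
    × (∀ t → ∃[ a ] (φ a ≐ ⟦ t ⟧))

module Submission where

-- For an anticlique T ⊆ X let Filt T be the filter generated by T and the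
-- complements of X ∖ T: a ∈ Filt T iff some "cell" ∏F ∧ -∑G lies below a,
-- with F ⊆ T and G ⊆ X ∖ T finite.  The isomorphism is φ(a) = {T : a ∈ Filt T}.
--
-- 1. Order facts in a Boolean algebra, and the cells ∏F ∧ -∑G.
-- 2. A cell whose lists cover the variables of a term t lies below t or
--    below -t; since X generates A, every element is the value of a term.
-- 3. Each Filt T is an ultrafilter: it decides every generated element
--    (by 2) and it is proper, because a zero product inside T contains a
--    minimal zero product, i.e. a hyperedge, and otherwise the
--    independence conditions forbid ∏F ≤ ∑G.
-- 4. Every nonzero generated element lies in some Filt T: refine the empty
--    cell variable by variable while keeping it nonzero; the list F of the
--    final cell is an anticlique.
-- 5. Hence φ is a Boolean homomorphism, injective by 4, and it sends each
--    term to its interpretation in BA(𝒢).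
-- Excluded middle (for propositions in Set) is used to decide membership in
-- T, whether a product vanishes, and whether a proper zero sublist exists.

open import Defs
open import Level using (0ℓ)
import Level
open import Axiom.ExcludedMiddle using (ExcludedMiddle)
open import Data.Product using (∃-syntax)
open import Relation.Unary using (Pred)
open import Relation.Binary.PropositionalEquality using (_≢_)

open import Data.Product using (_×_; _,_; proj₁; proj₂)
open import Data.Sum using (_⊎_; inj₁; inj₂; map₁; map₂; [_,_])
open import Data.Empty using (⊥-elim)
open import Data.Unit using (tt)
open import Function using (_∘_)
open import Data.Nat using (suc; _<_)
open import Data.Nat.Properties using (<-≤-trans; ≤-pred; n<1+n)
open import Data.List using (List; []; _∷_; _++_; length; filter)
open import Data.List.Properties using (filter-notAll)
open import Data.List.Relation.Unary.All using (All; []; _∷_; tabulate; lookup)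
import Data.List.Relation.Unary.All as All
open import Data.List.Relation.Unary.All.Properties using (++⁺)
open import Data.List.Relation.Unary.Any using (here; there)
import Data.List.Relation.Unary.Any as Any
open import Data.List.Membership.Propositional using (_∈_)
open import Data.List.Membership.Propositional.Properties
  using (∈-filter⁺; ∈-filter⁻; ∈-++⁺ˡ; ∈-++⁺ʳ)
open import Relation.Nullary using (¬_; yes; no)
open import Relation.Binary.PropositionalEquality
  using (_≡_; refl; sym; trans; cong; cong₂; subst; module ≡-Reasoning)
open import Relation.Unary using (_≐_; _⊆_; _∩_; _∪_; ∁; U; ∅)
  renaming (_∈_ to _∈ₚ_)
open import Relation.Unary.Properties using (≐-trans)
open import Relation.Unary.Algebra using (∩-cong; ∪-cong)
import Algebra.Lattice.Bundles as LB
import Algebra.Lattice.Properties.BooleanAlgebra as BooleanAlgebraProperties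
import Algebra.Lattice.Properties.Lattice as LatticeProperties
import Relation.Binary.Lattice.Bundles as OrderLattice

-- Order-theoretic facts in a Boolean algebra, with a ≤ b meaning a ≡ a ∧ b.
module BooleanOrder (𝔸 : BA) where

  booleanAlgebra : LB.BooleanAlgebra 0ℓ 0ℓ
  booleanAlgebra = record
    { Carrier = BA.Carrier 𝔸 ; _≈_ = _≡_ ; _∨_ = BA._∨_ 𝔸 ; _∧_ = BA._∧_ 𝔸
    ; ¬_ = BA.-_ 𝔸 ; ⊤ = BA.⊤ 𝔸 ; ⊥ = BA.⊥ 𝔸
    ; isBooleanAlgebra = BA.isBooleanAlgebra 𝔸 }

  open LB.BooleanAlgebra booleanAlgebra public
    using (Carrier; _∧_; _∨_; ⊤; ⊥; ∧-comm; ∧-assoc; ∧-distribʳ-∨;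
           ∧-distribˡ-∨; ∨-absorbs-∧; ∧-complementʳ; ∨-complementʳ)
    renaming (¬_ to -_)
  open BooleanAlgebraProperties booleanAlgebra public
    using (∧-identityʳ; ∧-identityˡ; ∨-identityʳ; ∧-zeroʳ; ∧-zeroˡ;
           ¬⊥≈⊤; ¬-involutive; deMorgan₂)
  open OrderLattice.Lattice
    (LatticeProperties.∨-∧-orderTheoreticLattice
      (LB.BooleanAlgebra.lattice booleanAlgebra)) public
    using (_≤_; x∧y≤x; x∧y≤y; ∧-greatest;
           x≤x∨y; y≤x∨y; ∨-least)
    renaming (refl to ≤-refl; trans to ≤-trans; antisym to ≤-antisym)
  open ≡-Reasoning

  x≤⊤ : ∀ x → x ≤ ⊤
  x≤⊤ x = sym (∧-identityʳ x)

  x≤⊥⇒x≡⊥ : ∀ {x} → x ≤ ⊥ → x ≡ ⊥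
  x≤⊥⇒x≡⊥ {x} x≤⊥ = trans x≤⊥ (∧-zeroʳ x)

  -‿antitone : ∀ {x y} → x ≤ y → - y ≤ - x
  -‿antitone {x} {y} x≤y = begin
    - y             ≡⟨ cong -_ y≡y∨x ⟩
    - (y ∨ x)       ≡⟨ deMorgan₂ y x ⟩
    - y ∧ - x       ∎
    where
    y≡y∨x : y ≡ y ∨ x
    y≡y∨x = sym (begin
      y ∨ x         ≡⟨ cong (y ∨_) x≤y ⟩
      y ∨ (x ∧ y)   ≡⟨ cong (y ∨_) (∧-comm x y) ⟩
      y ∨ (y ∧ x)   ≡⟨ ∨-absorbs-∧ y x ⟩
      y             ∎)

  disjoint⇒≤ : ∀ {x y} → x ∧ - y ≡ ⊥ → x ≤ y
  disjoint⇒≤ {x} {y} x∧-y≡⊥ = sym (begin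
    x ∧ y                   ≡⟨ sym (∨-identityʳ _) ⟩
    (x ∧ y) ∨ ⊥             ≡⟨ cong ((x ∧ y) ∨_) (sym x∧-y≡⊥) ⟩
    (x ∧ y) ∨ (x ∧ - y)     ≡⟨ sym (∧-distribˡ-∨ x y (- y)) ⟩
    x ∧ (y ∨ - y)           ≡⟨ cong (x ∧_) (∨-complementʳ y) ⟩
    x ∧ ⊤                   ≡⟨ ∧-identityʳ x ⟩
    x                       ∎)

  ≤-and-≤-⇒≡⊥ : ∀ {x y} → x ≤ y → x ≤ - y → x ≡ ⊥
  ≤-and-≤-⇒≡⊥ {y = y} x≤y x≤-y =
    x≤⊥⇒x≡⊥ (subst (_ ≤_) (∧-complementʳ y) (∧-greatest x≤y x≤-y))

  split-by : ∀ x y → x ∧ y ≡ ⊥ → - x ∧ y ≡ ⊥ → y ≡ ⊥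
  split-by x y x∧y≡⊥ -x∧y≡⊥ = begin
    y                       ≡⟨ sym (∧-identityˡ y) ⟩
    ⊤ ∧ y                   ≡⟨ cong (_∧ y) (sym (∨-complementʳ x)) ⟩
    (x ∨ - x) ∧ y           ≡⟨ ∧-distribʳ-∨ y x (- x) ⟩
    (x ∧ y) ∨ (- x ∧ y)     ≡⟨ cong₂ _∨_ x∧y≡⊥ -x∧y≡⊥ ⟩
    ⊥ ∨ ⊥                   ≡⟨ ∨-identityʳ ⊥ ⟩
    ⊥                       ∎

  Decides : Carrier → Carrier → Set
  Decides c a = c ≤ a ⊎ c ≤ - a

  decides-∧ : ∀ {c a b} → Decides c a → Decides c b → Decides c (a ∧ b)
  decides-∧ (inj₁ c≤a) (inj₁ c≤b) = inj₁ (∧-greatest c≤a c≤b)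
  decides-∧ (inj₂ c≤-a) _         = inj₂ (≤-trans c≤-a (-‿antitone (x∧y≤x _ _)))
  decides-∧ (inj₁ _)   (inj₂ c≤-b) = inj₂ (≤-trans c≤-b (-‿antitone (x∧y≤y _ _)))

  decides-∨ : ∀ {c a b} → Decides c a → Decides c b → Decides c (a ∨ b)
  decides-∨ (inj₁ c≤a)  _           = inj₁ (≤-trans c≤a (x≤x∨y _ _))
  decides-∨ (inj₂ _)    (inj₁ c≤b)  = inj₁ (≤-trans c≤b (y≤x∨y _ _))
  decides-∨ {a = a} {b} (inj₂ c≤-a) (inj₂ c≤-b) =
    inj₂ (subst (_ ≤_) (sym (deMorgan₂ a b)) (∧-greatest c≤-a c≤-b))

  decides-- : ∀ {c a} → Decides c a → Decides c (- a)
  decides-- (inj₁ c≤a)  = inj₂ (subst (_ ≤_) (sym (¬-involutive _)) c≤a)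
  decides-- (inj₂ c≤-a) = inj₁ c≤-a

module Cells (𝔸 : BA) where

  open BooleanOrder 𝔸

  ∏-lower : ∀ {x F} → x ∈ F → ∏ 𝔸 F ≤ x
  ∏-lower {F = y ∷ F} (here refl) = x∧y≤x _ _
  ∏-lower {F = y ∷ F} (there x∈F) = ≤-trans (x∧y≤y _ _) (∏-lower x∈F)

  ∏-antitone : ∀ {F} e → All (_∈ F) e → ∏ 𝔸 F ≤ ∏ 𝔸 e
  ∏-antitone []      []           = x≤⊤ _
  ∏-antitone (x ∷ e) (x∈F ∷ e⊆F) = ∧-greatest (∏-lower x∈F) (∏-antitone e e⊆F)

  ∑-upper : ∀ {x G} → x ∈ G → x ≤ ∑ 𝔸 G
  ∑-upper {G = y ∷ G} (here refl) = x≤x∨y _ _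
  ∑-upper {G = y ∷ G} (there x∈G) = ≤-trans (∑-upper x∈G) (y≤x∨y _ _)

  ∑-monotone : ∀ {H} G → All (_∈ H) G → ∑ 𝔸 G ≤ ∑ 𝔸 H
  ∑-monotone []      []           = sym (∧-zeroˡ _)
  ∑-monotone (x ∷ G) (x∈H ∷ G⊆H) = ∨-least (∑-upper x∈H) (∑-monotone G G⊆H)

  cell : List Carrier → List Carrier → Carrier
  cell F G = ∏ 𝔸 F ∧ - ∑ 𝔸 G

  cell-[] : cell [] [] ≡ ⊤
  cell-[] = trans (cong (⊤ ∧_) ¬⊥≈⊤) (∧-identityʳ ⊤)

  cell-antitone : ∀ F G {F′ G′} → All (_∈ F′) F → All (_∈ G′) G →
                  cell F′ G′ ≤ cell F G
  cell-antitone F G F⊆F′ G⊆G′ =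
    ∧-greatest (≤-trans (x∧y≤x _ _) (∏-antitone F F⊆F′))
               (≤-trans (x∧y≤y _ _) (-‿antitone (∑-monotone G G⊆G′)))

  cell-++ˡ : ∀ F G F′ G′ → cell (F ++ F′) (G ++ G′) ≤ cell F G
  cell-++ˡ F G F′ G′ = cell-antitone F G (tabulate ∈-++⁺ˡ) (tabulate ∈-++⁺ˡ)

  cell-++ʳ : ∀ F G F′ G′ → cell (F ++ F′) (G ++ G′) ≤ cell F′ G′
  cell-++ʳ F G F′ G′ = cell-antitone F′ G′ (tabulate (∈-++⁺ʳ F)) (tabulate (∈-++⁺ʳ G))

  cell-in : ∀ {x F G} → x ∈ F → cell F G ≤ x
  cell-in x∈F = ≤-trans (x∧y≤x _ _) (∏-lower x∈F)

  cell-out : ∀ {y F G} → y ∈ G → cell F G ≤ - y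
  cell-out y∈G = ≤-trans (x∧y≤y _ _) (-‿antitone (∑-upper y∈G))

  cell-∷ˡ : ∀ x F G → cell (x ∷ F) G ≡ x ∧ cell F G
  cell-∷ˡ x F G = ∧-assoc x (∏ 𝔸 F) (- ∑ 𝔸 G)

  cell-∷ʳ : ∀ x F G → cell F (x ∷ G) ≡ - x ∧ cell F G
  cell-∷ʳ x F G = begin
    ∏ 𝔸 F ∧ - (x ∨ ∑ 𝔸 G)        ≡⟨ cong (∏ 𝔸 F ∧_) (deMorgan₂ x (∑ 𝔸 G)) ⟩
    ∏ 𝔸 F ∧ (- x ∧ - ∑ 𝔸 G)      ≡⟨ sym (∧-assoc _ _ _) ⟩
    (∏ 𝔸 F ∧ - x) ∧ - ∑ 𝔸 G      ≡⟨ cong (_∧ - ∑ 𝔸 G) (∧-comm _ _) ⟩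
    (- x ∧ ∏ 𝔸 F) ∧ - ∑ 𝔸 G      ≡⟨ ∧-assoc _ _ _ ⟩
    - x ∧ cell F G                ∎
    where open ≡-Reasoning

  cell-split : ∀ x F G d → cell (x ∷ F) G ∧ d ≡ ⊥ → cell F (x ∷ G) ∧ d ≡ ⊥ →
               cell F G ∧ d ≡ ⊥
  cell-split x F G d missesˡ missesʳ = split-by x (cell F G ∧ d)
    (regroup (cell-∷ˡ x F G) missesˡ) (regroup (cell-∷ʳ x F G) missesʳ)
    where
    regroup : ∀ {y c} → c ≡ y ∧ cell F G → c ∧ d ≡ ⊥ → y ∧ (cell F G ∧ d) ≡ ⊥
    regroup {y} c≡y∧cell c∧d≡⊥ =
      trans (sym (∧-assoc y (cell F G) d)) (trans (cong (_∧ d) (sym c≡y∧cell)) c∧d≡⊥)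

module TermCells (𝔸 : BA) {V : Set} (ρ : V → BA.Carrier 𝔸) where

  open BooleanOrder 𝔸
  open Cells 𝔸

  ⟦_⟧ᴬ : BTerm V → Carrier
  ⟦_⟧ᴬ = evalA 𝔸 ρ

  vars : BTerm V → List Carrier
  vars (var v)   = ρ v ∷ []
  vars top       = []
  vars bot       = []
  vars (s and t) = vars s ++ vars t
  vars (s or t)  = vars s ++ vars t
  vars (not t)   = vars t

  Covers : List Carrier → List Carrier → List Carrier → Set
  Covers F G L = ∀ {x} → x ∈ L → x ∈ F ⊎ x ∈ G

  cover-∷ˡ : ∀ {x F G L} → Covers F G L → Covers (x ∷ F) G (x ∷ L)
  cover-∷ˡ covers (here refl) = inj₁ (here refl)
  cover-∷ˡ covers (there y∈L) = map₁ there (covers y∈L)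

  cover-∷ʳ : ∀ {x F G L} → Covers F G L → Covers F (x ∷ G) (x ∷ L)
  cover-∷ʳ covers (here refl) = inj₂ (here refl)
  cover-∷ʳ covers (there y∈L) = map₂ there (covers y∈L)

  cell-decides : ∀ {F G} t → Covers F G (vars t) → Decides (cell F G) ⟦ t ⟧ᴬ
  cell-decides {F} {G} (var v) covers with covers (here refl)
  ... | inj₁ v∈F = inj₁ (cell-in {G = G} v∈F)
  ... | inj₂ v∈G = inj₂ (cell-out {F = F} v∈G)
  cell-decides top _ = inj₁ (x≤⊤ _)
  cell-decides {F} {G} bot _ = inj₂ (subst (cell F G ≤_) (sym ¬⊥≈⊤) (x≤⊤ _))
  cell-decides (s and t) covers =
    decides-∧ (cell-decides s (covers ∘ ∈-++⁺ˡ)) (cell-decides t (covers ∘ ∈-++⁺ʳ _))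
  cell-decides (s or t) covers =
    decides-∨ (cell-decides s (covers ∘ ∈-++⁺ˡ)) (cell-decides t (covers ∘ ∈-++⁺ʳ _))
  cell-decides (not t) covers = decides-- (cell-decides t covers)

module Hypergraph (em : ExcludedMiddle 0ℓ) (𝔸 : BA) (X : Pred (BA.Carrier 𝔸) 0ℓ) where

  open BooleanOrder 𝔸
  open Cells 𝔸

  MinimalZero : List Carrier → Set
  MinimalZero e = ∏ 𝔸 e ≡ ⊥ ×
    (∀ f → All (_∈ e) f → (∃[ y ] (y ∈ e × ¬ (y ∈ f))) → ∏ 𝔸 f ≢ ⊥)

  -- Every zero product has a minimal zero sublist; by recursion on an upper
  -- bound k for its length, passing to a proper zero sublist when one exists.
  minimal-zero-sublist-bounded : ∀ k F → length F < k → ∏ 𝔸 F ≡ ⊥ →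
                                 ∃[ e ] (All (_∈ F) e × MinimalZero e)
  minimal-zero-sublist-bounded (suc k) F |F|<k ∏F≡⊥
    with em {∃[ f ] (All (_∈ F) f × (∃[ y ] (y ∈ F × ¬ (y ∈ f))) × ∏ 𝔸 f ≡ ⊥)}
  ... | no noProperZero =
    F , tabulate (λ x∈F → x∈F) , ∏F≡⊥ ,
    λ f f⊆F missing ∏f≡⊥ → noProperZero (f , f⊆F , missing , ∏f≡⊥)
  ... | yes (f , f⊆F , (y , y∈F , y∉f) , ∏f≡⊥)
    with minimal-zero-sublist-bounded k F′ shorter ∏F′≡⊥
    where
    in-f? = λ (z : Carrier) → em {z ∈ f}
    F′ = filter in-f? F
    shorter : length F′ < k
    shorter = <-≤-trans (filter-notAll in-f? F (Any.map (λ { refl → y∉f }) y∈F))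
                        (≤-pred |F|<k)
    ∏F′≡⊥ : ∏ 𝔸 F′ ≡ ⊥
    ∏F′≡⊥ = x≤⊥⇒x≡⊥ (subst (∏ 𝔸 F′ ≤_) ∏f≡⊥
      (∏-antitone f (tabulate (λ z∈f → ∈-filter⁺ in-f? (lookup f⊆F z∈f) z∈f))))
  ... | e , e⊆F′ , minimal =
    e , All.map (λ z∈F′ → proj₁ (∈-filter⁻ (λ z → em {z ∈ f}) z∈F′)) e⊆F′ , minimal

  zero-product-includes-hyperedge : ∀ F → All X F → ∏ 𝔸 F ≡ ⊥ →
                                    ∃[ e ] (All (_∈ F) e × Hyperedge 𝔸 X e)
  zero-product-includes-hyperedge F F⊆X ∏F≡⊥
    with minimal-zero-sublist-bounded (suc (length F)) F (n<1+n _) ∏F≡⊥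
  ... | e , e⊆F , minimal = e , e⊆F , All.map (lookup F⊆X) e⊆F , minimal

  nonzero-cell-anticlique : ∀ F G → All X F → cell F G ≢ ⊥ →
                            IsAnticlique 𝔸 X (_∈ F)
  nonzero-cell-anticlique F G F⊆X cell≢⊥ =
    lookup F⊆X ,
    λ e (_ , ∏e≡⊥ , _) e⊆F → cell≢⊥ (x≤⊥⇒x≡⊥
      (≤-trans (x∧y≤x _ _) (subst (∏ 𝔸 F ≤_) ∏e≡⊥ (∏-antitone e e⊆F))))

  nonzero-cell-disjoint : ∀ {F G y} → cell F G ≢ ⊥ → y ∈ G → ¬ (y ∈ F)
  nonzero-cell-disjoint {F} {G} cell≢⊥ y∈G y∈F =
    cell≢⊥ (≤-and-≤-⇒≡⊥ (cell-in {G = G} y∈F) (cell-out {F = F} y∈G))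

module AnticliqueFilter (em : ExcludedMiddle 0ℓ) (𝔸 : BA) (X : Pred (BA.Carrier 𝔸) 0ℓ) where

  open BooleanOrder 𝔸
  open Cells 𝔸
  open Hypergraph em 𝔸 X
  open TermCells 𝔸 {Vtx 𝔸 X} proj₁ public

  Outside : Pred Carrier 0ℓ → Carrier → Set
  Outside T y = y ∈ₚ X × ¬ (y ∈ₚ T)

  Filt : Pred Carrier 0ℓ → Carrier → Set
  Filt T a = ∃[ F ] ∃[ G ] (All (_∈ₚ T) F × All (Outside T) G × cell F G ≤ a)

  filt-mono : ∀ {T a b} → Filt T a → a ≤ b → Filt T b
  filt-mono (F , G , F⊆T , G⊆out , cell≤a) a≤b = F , G , F⊆T , G⊆out , ≤-trans cell≤a a≤b

  filt-∧ : ∀ {T a b} → Filt T a → Filt T b → Filt T (a ∧ b)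
  filt-∧ (F , G , F⊆T , G⊆out , cell≤a) (F′ , G′ , F′⊆T , G′⊆out , cell′≤b) =
    F ++ F′ , G ++ G′ , ++⁺ F⊆T F′⊆T , ++⁺ G⊆out G′⊆out ,
    ∧-greatest
      (≤-trans (cell-++ˡ F G F′ G′) cell≤a) (≤-trans (cell-++ʳ F G F′ G′) cell′≤b)

  vars-in-X : ∀ t → All X (vars t)
  vars-in-X (var (x , x∈X)) = x∈X ∷ []
  vars-in-X top       = []
  vars-in-X bot       = []
  vars-in-X (s and t) = ++⁺ (vars-in-X s) (vars-in-X t)
  vars-in-X (s or t)  = ++⁺ (vars-in-X s) (vars-in-X t)
  vars-in-X (not t)   = vars-in-X t

  split-by-membership : ∀ T L → All X L →
    ∃[ F ] ∃[ G ] (All (_∈ₚ T) F × All (Outside T) G × Covers F G L)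
  split-by-membership T [] [] = [] , [] , [] , [] , λ ()
  split-by-membership T (x ∷ L) (x∈X ∷ L⊆X) with split-by-membership T L L⊆X | em {x ∈ₚ T}
  ... | F , G , F⊆T , G⊆out , covers | yes x∈T =
    x ∷ F , G , x∈T ∷ F⊆T , G⊆out , cover-∷ˡ covers
  ... | F , G , F⊆T , G⊆out , covers | no x∉T =
    F , x ∷ G , F⊆T , (x∈X , x∉T) ∷ G⊆out , cover-∷ʳ covers

  filt-decides : ∀ T t → Filt T ⟦ t ⟧ᴬ ⊎ Filt T (- ⟦ t ⟧ᴬ)
  filt-decides T t with split-by-membership T (vars t) (vars-in-X t)
  ... | F , G , F⊆T , G⊆out , covers with cell-decides t covers
  ... | inj₁ cell≤t  = inj₁ (F , G , F⊆T , G⊆out , cell≤t)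
  ... | inj₂ cell≤-t = inj₂ (F , G , F⊆T , G⊆out , cell≤-t)

  -- Conditions 1 and 3 of independence: no finite sum of members of X is ⊤,
  -- and a nonzero product below a sum shares a member with it.
  NoSumIsTop : Set
  NoSumIsTop = ∀ F → NEFinSub 𝔸 X F → ∑ 𝔸 F ≢ ⊤

  ProductBelowSumShares : Set
  ProductBelowSumShares = ∀ F G → NEFinSub 𝔸 X F → NEFinSub 𝔸 X G →
    ∏ 𝔸 F ≢ ⊥ → _≤ᴬ_ 𝔸 (∏ 𝔸 F) (∑ 𝔸 G) → ∃[ x ] (x ∈ F × x ∈ G)

  product-not-below-sum : NoSumIsTop → ProductBelowSumShares →
    ∀ {T} → T ⊆ X → ∀ F G → All (_∈ₚ T) F → All (Outside T) G →
    ∏ 𝔸 F ≢ ⊥ → ¬ (∏ 𝔸 F ≤ ∑ 𝔸 G)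
  product-not-below-sum _ _ _ F [] _ _ ∏F≢⊥ ∏F≤⊥ = ∏F≢⊥ (x≤⊥⇒x≡⊥ ∏F≤⊥)
  product-not-below-sum noSumIsTop _ _ [] (g ∷ G) _ G⊆out _ ⊤≤∑G =
    noSumIsTop (g ∷ G) ((g , here refl) , All.map proj₁ G⊆out)
      (sym (trans ⊤≤∑G (∧-identityˡ _)))
  product-not-below-sum _ shares T⊆X (f ∷ F) (g ∷ G) F⊆T G⊆out ∏F≢⊥ ∏F≤∑G
    with shares (f ∷ F) (g ∷ G) ((f , here refl) , All.map T⊆X F⊆T)
                ((g , here refl) , All.map proj₁ G⊆out) ∏F≢⊥ (sym ∏F≤∑G)
  ... | x , x∈F , x∈G = proj₂ (lookup G⊆out x∈G) (lookup F⊆T x∈F)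

  -- The filter of an anticlique of an independent set is proper: a zero
  -- product inside T would include a hyperedge.
  filt-proper : NoSumIsTop → ProductBelowSumShares →
    ∀ {T} → IsAnticlique 𝔸 X T → ¬ Filt T ⊥
  filt-proper noSumIsTop shares (T⊆X , noEdge) (F , G , F⊆T , G⊆out , cell≤⊥)
    with em {∏ 𝔸 F ≡ ⊥}
  ... | yes ∏F≡⊥ with zero-product-includes-hyperedge F (All.map T⊆X F⊆T) ∏F≡⊥
  ...   | e , e⊆F , edge = noEdge e edge (All.map (lookup F⊆T) e⊆F)
  filt-proper noSumIsTop shares (T⊆X , _) (F , G , F⊆T , G⊆out , cell≤⊥)
      | no ∏F≢⊥ =
    product-not-below-sum noSumIsTop shares T⊆X F G F⊆T G⊆out ∏F≢⊥
      (disjoint⇒≤ (x≤⊥⇒x≡⊥ cell≤⊥))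

  -- A cell meeting d can be refined to cover the vertices of L while still
  -- meeting d: at each vertex x one of the two halves must meet d.
  refine : ∀ d L → All X L → d ≢ ⊥ →
    ∃[ F ] ∃[ G ] (All X F × All X G × cell F G ∧ d ≢ ⊥ × Covers F G L)
  refine d [] [] d≢⊥ = [] , [] , [] , [] , meets , λ ()
    where
    meets : cell [] [] ∧ d ≢ ⊥
    meets misses = d≢⊥ (begin
      d                ≡⟨ sym (∧-identityˡ d) ⟩
      ⊤ ∧ d            ≡⟨ cong (_∧ d) (sym cell-[]) ⟩
      cell [] [] ∧ d   ≡⟨ misses ⟩
      ⊥                ∎)
      where open ≡-Reasoning
  refine d (x ∷ L) (x∈X ∷ L⊆X) d≢⊥ with refine d L L⊆X d≢⊥
  ... | F , G , F⊆X , G⊆X , meets , covers with em {cell (x ∷ F) G ∧ d ≡ ⊥}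
  ...   | no meetsˡ = x ∷ F , G , x∈X ∷ F⊆X , G⊆X , meetsˡ , cover-∷ˡ covers
  ...   | yes missesˡ = F , x ∷ G , F⊆X , x∈X ∷ G⊆X ,
                        (λ missesʳ → meets (cell-split x F G d missesˡ missesʳ)) ,
                        cover-∷ʳ covers

  nonzero-in-filt : ∀ t → ⟦ t ⟧ᴬ ≢ ⊥ → ∃[ T ] (IsAnticlique 𝔸 X T × Filt T ⟦ t ⟧ᴬ)
  nonzero-in-filt t t≢⊥ with refine ⟦ t ⟧ᴬ (vars t) (vars-in-X t) t≢⊥
  ... | F , G , F⊆X , G⊆X , meets , covers with cell-decides t covers
  ...   | inj₂ cell≤-t = ⊥-elim (meets (≤-and-≤-⇒≡⊥
          (x∧y≤y (cell F G) ⟦ t ⟧ᴬ) (≤-trans (x∧y≤x (cell F G) ⟦ t ⟧ᴬ) cell≤-t)))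
  ...   | inj₁ cell≤t =
    (_∈ F) , nonzero-cell-anticlique F G F⊆X cell≢⊥ ,
    F , G , tabulate (λ y∈F → y∈F) ,
    tabulate (λ y∈G → lookup G⊆X y∈G , nonzero-cell-disjoint cell≢⊥ y∈G) , cell≤t
    where
    cell≢⊥ : cell F G ≢ ⊥
    cell≢⊥ cell≡⊥ = meets (trans (cong (_∧ ⟦ t ⟧ᴬ) cell≡⊥) (∧-zeroˡ ⟦ t ⟧ᴬ))

module Representation (em : ExcludedMiddle 0ℓ) (𝔸 : BA) (X : Pred (BA.Carrier 𝔸) 0ℓ)
  (noSumIsTop : AnticliqueFilter.NoSumIsTop em 𝔸 X)
  (shares : AnticliqueFilter.ProductBelowSumShares em 𝔸 X)
  (generates : Generates 𝔸 X) where

  open BooleanOrder 𝔸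
  open Cells 𝔸
  open AnticliqueFilter em 𝔸 X

  φ : Carrier → Pred (Anticlique 𝔸 X) 0ℓ
  φ a (T , _) = Filt T a

  filt-ultra : ∀ T a → Filt T a ⊎ Filt T (- a)
  filt-ultra T a with generates a
  ... | t , t≡a = subst (λ b → Filt T b ⊎ Filt T (- b)) t≡a (filt-decides T t)

  filt-consistent : ∀ {T a} → IsAnticlique 𝔸 X T → Filt T a → ¬ Filt T (- a)
  filt-consistent {a = a} anticlique a∈T -a∈T = filt-proper noSumIsTop shares anticlique
    (filt-mono (filt-∧ a∈T -a∈T) (subst (_≤ ⊥) (sym (∧-complementʳ a)) ≤-refl))

  φ-∧ : ∀ a b → φ (a ∧ b) ≐ (φ a ∩ φ b)
  φ-∧ a b = (λ p → filt-mono p (x∧y≤x a b) , filt-mono p (x∧y≤y a b))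
          , (λ (p , q) → filt-∧ p q)

  φ-∨ : ∀ a b → φ (a ∨ b) ≐ (φ a ∪ φ b)
  φ-∨ a b = (λ {T} → to {T})
          , [ (λ p → filt-mono p (x≤x∨y a b)) , (λ q → filt-mono q (y≤x∨y a b)) ]
    where
    -- if neither a nor b is in Filt T, both complements are, hence so is
    -- - a ∧ - b = -(a ∨ b), contradicting consistency
    to : φ (a ∨ b) ⊆ (φ a ∪ φ b)
    to {T , anticlique} p with filt-ultra T a | filt-ultra T b
    ... | inj₁ a∈T  | _        = inj₁ a∈T
    ... | inj₂ _    | inj₁ b∈T = inj₂ b∈T
    ... | inj₂ -a∈T | inj₂ -b∈T = ⊥-elim (filt-consistent anticlique p
            (subst (Filt T) (sym (deMorgan₂ a b)) (filt-∧ -a∈T -b∈T)))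

  φ-- : ∀ a → φ (- a) ≐ ∁ (φ a)
  φ-- a = (λ { {T , anticlique} -a∈T a∈T → filt-consistent anticlique a∈T -a∈T })
        , (λ {T} → from {T})
    where
    from : ∁ (φ a) ⊆ φ (- a)
    from {T , _} a∉T with filt-ultra T a
    ... | inj₁ a∈T  = ⊥-elim (a∉T a∈T)
    ... | inj₂ -a∈T = -a∈T

  φ-⊤ : φ ⊤ ≐ U
  φ-⊤ = (λ _ → tt) , (λ _ → [] , [] , [] , [] , x≤⊤ _)

  φ-⊥ : φ ⊥ ≐ ∅
  φ-⊥ = (λ { {_ , anticlique} ⊥∈T → filt-proper noSumIsTop shares anticlique ⊥∈T }) , λ ()

  -- φ reflects the order: a nonzero a ∧ - b lies in some Filt T, which then
  -- contains a but not b.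
  φ-reflects-≤ : ∀ a b → φ a ⊆ φ b → a ≤ b
  φ-reflects-≤ a b φa⊆φb with em {a ∧ - b ≡ ⊥}
  ... | yes a∧-b≡⊥ = disjoint⇒≤ a∧-b≡⊥
  ... | no a∧-b≢⊥ with generates (a ∧ - b)
  ...   | t , t≡a∧-b with nonzero-in-filt t (λ t≡⊥ → a∧-b≢⊥ (trans (sym t≡a∧-b) t≡⊥))
  ...     | T , anticlique , t∈T =
    ⊥-elim (filt-consistent anticlique
      (φa⊆φb {T , anticlique} (filt-mono a∧-b∈T (x∧y≤x a (- b))))
      (filt-mono a∧-b∈T (x∧y≤y a (- b))))
    where
    a∧-b∈T : Filt T (a ∧ - b)
    a∧-b∈T = subst (Filt T) t≡a∧-b t∈T

  φ-injective : ∀ a b → φ a ≐ φ b → a ≡ b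
  φ-injective a b (φa⊆φb , φb⊆φa) =
    ≤-antisym (φ-reflects-≤ a b (λ {T} → φa⊆φb {T}))
              (φ-reflects-≤ b a (λ {T} → φb⊆φa {T}))

  φ-vertex : ∀ x → x ∈ₚ X → φ x ≐ _₊ 𝔸 {X} x
  φ-vertex x x∈X = (λ {T} → to {T}) , (λ { {T , _} x∈T → x∈T-gives-x∈Filt x∈T })
    where
    x∈T-gives-x∈Filt : ∀ {T} → x ∈ₚ T → Filt T x
    x∈T-gives-x∈Filt x∈T =
      x ∷ [] , [] , x∈T ∷ [] , [] , cell-in {F = x ∷ []} {G = []} (here refl)

    to : φ x ⊆ _₊ 𝔸 {X} x
    to {T , anticlique} x∈FiltT with em {x ∈ₚ T}
    ... | yes x∈T = x∈T
    ... | no x∉T = ⊥-elim (filt-consistent anticlique x∈FiltT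
                     ([] , x ∷ [] , [] , (x∈X , x∉T) ∷ [] ,
                      cell-out {F = []} {G = x ∷ []} (here refl)))

  ∁-cong : ∀ {P Q : Pred (Anticlique 𝔸 X) 0ℓ} → P ≐ Q → ∁ P ≐ ∁ Q
  ∁-cong (P⊆Q , Q⊆P) = (λ ∉P ∈Q → ∉P (Q⊆P ∈Q)) , (λ ∉Q ∈P → ∉Q (P⊆Q ∈P))

  φ-term : ∀ t → φ ⟦ t ⟧ᴬ ≐ ⟦_⟧ 𝔸 t
  φ-term (var (x , x∈X)) = φ-vertex x x∈X
  φ-term top       = φ-⊤
  φ-term bot       = φ-⊥
  φ-term (s and t) = ≐-trans (φ-∧ ⟦ s ⟧ᴬ ⟦ t ⟧ᴬ) (∩-cong (φ-term s) (φ-term t))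
  φ-term (s or t)  = ≐-trans (φ-∨ ⟦ s ⟧ᴬ ⟦ t ⟧ᴬ) (∪-cong (φ-term s) (φ-term t))
  φ-term (not t)   = ≐-trans (φ-- ⟦ t ⟧ᴬ) (∁-cong (φ-term t))

  φ-isomorphism : IsIsoOntoBA𝒢 𝔸 X φ
  φ-isomorphism =
    φ-∧ , φ-∨ , φ-- , φ-⊤ , φ-⊥ , φ-injective , φ-vertex ,
    (λ a → onto a (generates a)) , (λ t → ⟦ t ⟧ᴬ , φ-term t)
    where
    onto : ∀ a → ∃[ t ] (⟦ t ⟧ᴬ ≡ a) → ∃[ t ] (φ a ≐ ⟦_⟧ 𝔸 t)
    onto a (t , refl) = t , φ-term t

mainTheorem10 : ExcludedMiddle 0ℓ → ExcludedMiddle (Level.suc 0ℓ) →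
    (𝔸 : BA) (n : Card) → n ≢ fin 0 → (X : Pred (BA.Carrier 𝔸) 0ℓ) →
    Independent 𝔸 n X → Generates 𝔸 X →
    ∃[ φ ] IsIsoOntoBA𝒢 𝔸 X φ
mainTheorem10 em _ 𝔸 _ _ X (_ , noSumIsTop , _ , shares) generates =
  Representation.φ em 𝔸 X noSumIsTop shares generates ,
  Representation.φ-isomorphism em 𝔸 X noSumIsTop shares generates
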